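{- Let $I$ be an AI instance with decomposition $I=O'\cup\bigcup_{k=1}^h\{a_k,b_k,c_k\}$ as in the context, and let $I'=I\setminus O'=\bigcup_{k=1}^h\{a_k,b_k,c_k\}$. Suppose $I'\neq\emptyset$. For an item $a\in I'$ let $F(a)$ be the set of multisets $\{x,y\}$ of integers for which there exist distinct items $b,c\in I'\setminus\{a\}$ with $w_b=x$, $w_c=y$ and $w_a+x+y=W$. Then: (i) there exists an item $a\in I'$ with $|F(a)|=1$; (ii) for any item $a\in I'$ with $|F(a)|=1$, say $F(a)=\{\{x,y\}\}$, there exists $k\in\{1,\dots,h\}$ such that $\{w_a,x,y\}=\{w_{a_k},w_{b_k},w_{c_k}\}$ as multisets.
   Context: A Bin Packing Problem (BPP) instance consists of a finite set of items, each item $i$ with a positive integer weight $w_i$, and a positive integer bin capacity $W$. For an instance $J$, $z_{\mathrm{ILP}}^J$ denotes the minimum number of bins of capacity $W$ into which $J$ can be partitioned, and $z_{\mathrm{LP}}^J$ the optimal value of the linear relaxation of the set covering formulation $\min\sum_P x_P$ s.t. $\sum_P a_{iP}x_P\ge1$ for every item $i$, $x\ge0$, over all multisets $P$ of items of total weight at most $W$ ($a_{iP}$ the multiplicity of $i$ in $P$). An ANI instance is a BPP instance $I_0$ with capacity $W$ whose items are partitioned as $I_0=O\cup\bigcup_{k=1}^h\{a_k,b_k,c_k\}$ ($h\ge0$) with $|O|=15$, $\sum_{i\in O}w_i=3W$, $z_{\mathrm{LP}}^O=3$, $z_{\mathrm{ILP}}^O=4$, $w_{a_k}+w_{b_k}+w_{c_k}=W$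 for each $k$, and for each $k$ no subset $S\subseteq O\cup\{a_g,b_g,c_g:1\le g\le k-1\}$ satisfies $\sum_{i\in S}w_i+w_{a_k}=W$. An AI instance $I$ is obtained from such an ANI instance by choosing $o\in O$ and replacing it by two items $o_1,o_2$ with positive integer weights summing to $w_o$, such that $O'=(O\setminus\{o\})\cup\{o_1,o_2\}$ satisfies $z_{\mathrm{LP}}^{O'}=z_{\mathrm{ILP}}^{O'}=3$; thus $I=O'\cup\bigcup_{k=1}^h\{a_k,b_k,c_k\}$. -}

module Defs where

open import Data.Nat using (ℕ; zero; suc; _+_; _*_; _≤_; _<_)
open import Data.Fin using (Fin; zero; suc; _≟_)
open import Data.Bool using (Bool; true; false; if_then_else_)
open import Data.Product using (Σ; _×_; _,_; ∃; ∃-syntax)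
open import Data.Sum using (_⊎_)
open import Data.List using (List; []; _∷_)
open import Data.List.Relation.Binary.Permutation.Propositional using (_↭_)
open import Data.Integer using (+_)
open import Relation.Binary.PropositionalEquality using (_≡_; _≢_)
open import Relation.Nullary using (¬_; yes; no)
import Data.Rational as Q
open Q using (ℚ)

Σℕ : ∀ {n} → (Fin n → ℕ) → ℕ
Σℕ {zero} f = 0
Σℕ {suc n} f = f zero + Σℕ (λ i → f (suc i))

Σℚ : ∀ {n} → (Fin n → ℚ) → ℚ
Σℚ {zero} f = Q.0ℚ
Σℚ {suc n} f = f zero Q.+ Σℚ (λ i → f (suc i))

ℕ→ℚ : ℕ → ℚ
ℕ→ℚ n = + n Q./ 1

-- A BPP instance on item set Fin n, with weights w and capacity W.
-- A pattern P is a multiset of items, given by its multiplicity function,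
-- of total weight at most W.
Pattern : ∀ {n} → (Fin n → ℕ) → ℕ → (Fin n → ℕ) → Set
Pattern w W P = Σℕ (λ i → P i * w i) ≤ W

-- An LP solution, listing the (finitely many) patterns with their
-- (rational) values x_P; patterns not listed have x_P = 0.
LPSol : ℕ → Set
LPSol n = List ((Fin n → ℕ) × ℚ)

lpValue : ∀ {n} → LPSol n → ℚ
lpValue [] = Q.0ℚ
lpValue ((P , x) ∷ s) = x Q.+ lpValue s

coverage : ∀ {n} → LPSol n → Fin n → ℚ
coverage [] i = Q.0ℚ
coverage ((P , x) ∷ s) i = (ℕ→ℚ (P i) Q.* x) Q.+ coverage s i

data AllPatterns {n} (w : Fin n → ℕ) (W : ℕ) : LPSol n → Set where
  []  : AllPatterns w W []
  _∷_ : ∀ {P x s} → Pattern w W P × Q.0ℚ Q.≤ x → AllPatterns w W s →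
        AllPatterns w W ((P , x) ∷ s)

LPFeasible : ∀ {n} → (Fin n → ℕ) → ℕ → LPSol n → Set
LPFeasible w W s = AllPatterns w W s × (∀ i → Q.1ℚ Q.≤ coverage s i)

zLP≡ : ∀ {n} → (Fin n → ℕ) → ℕ → ℚ → Set
zLP≡ w W v =
  (Σ (LPSol _) λ s → LPFeasible w W s × lpValue s ≡ v) ×
  (∀ s → LPFeasible w W s → v Q.≤ lpValue s)

load : ∀ {n m} → (Fin n → ℕ) → (Fin n → Fin m) → Fin m → ℕ
load w f b = Σℕ (λ i → if isYes (f i ≟ b) then w i else 0)
  where
  isYes : ∀ {A : Set} → Relation.Nullary.Dec A → Bool
  isYes (yes _) = true
  isYes (no _)  = false

Packable : ∀ {n} → (Fin n → ℕ) → ℕ → ℕ → Set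
Packable {n} w W m = Σ (Fin n → Fin m) λ f → ∀ b → load w f b ≤ W

zILP≡ : ∀ {n} → (Fin n → ℕ) → ℕ → ℕ → Set
zILP≡ w W k = Packable w W k × (∀ m → Packable w W m → k ≤ m)

sel : Bool → ℕ → ℕ
sel b x = if b then x else 0

-- ANI instance. Items of O are Fin 15; items a_k, b_k, c_k are
-- (k , 0), (k , 1), (k , 2) with weights wT k 0, wT k 1, wT k 2.
record ANI : Set where
  field
    W      : ℕ
    W-pos  : 0 < W
    wO     : Fin 15 → ℕ
    wO-pos : ∀ i → 0 < wO i
    h      : ℕ
    wT     : Fin h → Fin 3 → ℕ
    wT-pos : ∀ k r → 0 < wT k r
    sumO   : Σℕ wO ≡ 3 * W
    lpO    : zLP≡ wO W (ℕ→ℚ 3)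
    ilpO   : zILP≡ wO W 4
    triple : ∀ k → wT k zero + wT k (suc zero) + wT k (suc (suc zero)) ≡ W
    noSub  : ∀ k (sO : Fin 15 → Bool) (sT : Fin h → Fin 3 → Bool) →
             (∀ g r → sT g r ≡ true → Data.Fin._<_ g k) →
             Σℕ (λ i → sel (sO i) (wO i)) +
             Σℕ (λ g → Σℕ (λ r → sel (sT g r) (wT g r))) + wT k zero ≢ W

-- O' = (O \ {o}) ∪ {o₁, o₂}, items Fin 16: item 0 is o₁, item (suc o) is o₂,
-- item (suc i) for i ≢ o is the item i of O.
splitO : (Fin 15 → ℕ) → Fin 15 → ℕ → ℕ → Fin 16 → ℕ
splitO wO o o₁ o₂ zero = o₁
splitO wO o o₁ o₂ (suc i) with i ≟ o
... | yes _ = o₂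
... | no _  = wO i

record AI : Set where
  field
    base   : ANI
  open ANI base
  field
    o      : Fin 15
    o₁ o₂  : ℕ
    o₁-pos : 0 < o₁
    o₂-pos : 0 < o₂
    split  : o₁ + o₂ ≡ wO o
    lpO'   : zLP≡ (splitO wO o o₁ o₂) W (ℕ→ℚ 3)
    ilpO'  : zILP≡ (splitO wO o o₁ o₂) W 3

Item' : ℕ → Set
Item' h = Fin h × Fin 3

InF : ∀ {h} → (Fin h → Fin 3 → ℕ) → ℕ → Item' h → ℕ → ℕ → Set
InF {h} wT W (ka , ra) x y =
  Σ (Item' h) λ { (kb , rb) → Σ (Item' h) λ { (kc , rc) →
    ((kb , rb) ≢ (kc , rc)) × ((kb , rb) ≢ (ka , ra)) × ((kc , rc) ≢ (ka , ra)) ×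
    wT kb rb ≡ x × wT kc rc ≡ y × wT ka ra + x + y ≡ W } }

SameMultiset2 : ℕ → ℕ → ℕ → ℕ → Set
SameMultiset2 x' y' x y = (x' ≡ x × y' ≡ y) ⊎ (x' ≡ y × y' ≡ x)

FSingleton : ∀ {h} → (Fin h → Fin 3 → ℕ) → ℕ → Item' h → ℕ → ℕ → Set
FSingleton wT W a x y =
  InF wT W a x y × (∀ x' y' → InF wT W a x' y' → SameMultiset2 x' y' x y)

-- Every completion of a_h inside I' lies in its own triple: a pair of earlier
-- items completing a_h is excluded by the ANI condition, and once one partner
-- is b_h or c_h the other partner's weight is forced.  Hence F(a_h) is the
-- single pair {w(b_h), w(c_h)}.  Conversely, for any item of a triple k the
-- other two items of that triple always give an element of F, so if F is a
-- singleton, it is that pair and the three weights are those of triple k.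
module Submission where

open import Defs
open import Data.Bool using (Bool; true; false; _∧_; _∨_)
open import Data.Empty using (⊥-elim)
open import Data.Fin using (Fin; zero; suc; fromℕ; _≟_) renaming (_<_ to _<ᶠ_)
open import Data.Fin.Properties using (≤fromℕ; ≤∧≢⇒<)
open import Data.List using (_∷_; []; tabulate)
open import Data.List.Relation.Binary.Permutation.Propositional
  using (_↭_; refl; prep; swap; trans; ↭-sym)
open import Data.List.Relation.Binary.Permutation.Propositional.Properties using (shift)
open import Data.Nat using (ℕ; zero; suc; _+_; _<_)
open import Data.Nat.ListAction using (sum)
open import Data.Nat.ListAction.Properties using (sum-↭)
open import Data.Nat.Properties
  using (+-assoc; +-identityʳ; +-cancelˡ-≡; +-commutativeSemigroup)
open import Algebra.Properties.CommutativeSemigroup +-commutativeSemigroup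
  using (interchange; xy∙z≈xz∙y; xy∙z≈zx∙y)
open import Data.Product using (Σ; _×_; _,_; proj₁; proj₂; uncurry)
open import Data.Sum using (_⊎_; inj₁; inj₂)
open import Relation.Binary.PropositionalEquality
  using (_≡_; _≢_; refl; sym; cong; cong₂; subst; module ≡-Reasoning)
  renaming (trans to ≡-trans)
open import Relation.Nullary using (¬_; does; yes; no)

open ≡-Reasoning

Σℕ-zero : ∀ n → Σℕ {n} (λ _ → 0) ≡ 0
Σℕ-zero zero    = refl
Σℕ-zero (suc n) = Σℕ-zero n

Σℕ-cong : ∀ {n} {f g : Fin n → ℕ} → (∀ i → f i ≡ g i) → Σℕ f ≡ Σℕ g
Σℕ-cong {zero}  f≡g = refl
Σℕ-cong {suc n} f≡g = cong₂ _+_ (f≡g zero) (Σℕ-cong (λ i → f≡g (suc i)))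

Σℕ-+ : ∀ {n} (f g : Fin n → ℕ) → Σℕ (λ i → f i + g i) ≡ Σℕ f + Σℕ g
Σℕ-+ {zero}  f g = refl
Σℕ-+ {suc n} f g = begin
  f zero + g zero + Σℕ (λ i → f (suc i) + g (suc i))
    ≡⟨ cong (f zero + g zero +_) (Σℕ-+ (λ i → f (suc i)) (λ i → g (suc i))) ⟩
  f zero + g zero + (Σℕ (λ i → f (suc i)) + Σℕ (λ i → g (suc i)))
    ≡⟨ interchange (f zero) (g zero) _ _ ⟩
  f zero + Σℕ (λ i → f (suc i)) + (g zero + Σℕ (λ i → g (suc i))) ∎

Σℕ-sel : ∀ {n} b (f : Fin n → ℕ) → Σℕ (λ i → sel b (f i)) ≡ sel b (Σℕ f)
Σℕ-sel {n} false f = Σℕ-zero n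
Σℕ-sel     true  f = refl

Σℕ-indicator : ∀ {n} (j : Fin n) (f : Fin n → ℕ) →
               Σℕ (λ i → sel (does (i ≟ j)) (f i)) ≡ f j
Σℕ-indicator {suc n} zero    f =
  ≡-trans (cong (f zero +_) (Σℕ-zero n)) (+-identityʳ (f zero))
Σℕ-indicator {suc n} (suc j) f = Σℕ-indicator j (λ i → f (suc i))

sel-∧ : ∀ a b x → sel (a ∧ b) x ≡ sel a (sel b x)
sel-∧ true  b x = refl
sel-∧ false b x = refl

sel-∨ : ∀ a b x → ¬ (a ≡ true × b ≡ true) → sel (a ∨ b) x ≡ sel a x + sel b x
sel-∨ true  true  x both = ⊥-elim (both (refl , refl))
sel-∨ true  false x _    = sym (+-identityʳ x)
sel-∨ false b     x _    = refl

Σ² : ∀ {m n} → (Fin m → Fin n → ℕ) → ℕ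
Σ² f = Σℕ (λ g → Σℕ (f g))

Σ²-cong : ∀ {m n} {f f′ : Fin m → Fin n → ℕ} →
          (∀ g r → f g r ≡ f′ g r) → Σ² f ≡ Σ² f′
Σ²-cong f≡f′ = Σℕ-cong (λ g → Σℕ-cong (f≡f′ g))

Σ²-+ : ∀ {m n} (f f′ : Fin m → Fin n → ℕ) →
       Σ² (λ g r → f g r + f′ g r) ≡ Σ² f + Σ² f′
Σ²-+ f f′ =
  ≡-trans (Σℕ-cong (λ g → Σℕ-+ (f g) (f′ g))) (Σℕ-+ (λ g → Σℕ (f g)) (λ g → Σℕ (f′ g)))

indicator : ∀ {m n} → Fin m × Fin n → Fin m → Fin n → Bool
indicator (k , s) g r = does (g ≟ k) ∧ does (r ≟ s)

indicator-sound : ∀ {m n} (p : Fin m × Fin n) g r → indicator p g r ≡ true → (g , r) ≡ p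
indicator-sound (k , s) g r hit with g ≟ k | r ≟ s
... | yes refl | yes refl = refl
indicator-sound (k , s) g r () | no _  | _
indicator-sound (k , s) g r () | yes _ | no _

indicator-∨-sound : ∀ {m n} (p q : Fin m × Fin n) g r →
                    indicator p g r ∨ indicator q g r ≡ true → (g , r) ≡ p ⊎ (g , r) ≡ q
indicator-∨-sound p q g r hit with indicator p g r in hit-p
... | true  = inj₁ (indicator-sound p g r hit-p)
... | false = inj₂ (indicator-sound q g r hit)

Σ²-indicator : ∀ {m n} (f : Fin m → Fin n → ℕ) (p : Fin m × Fin n) →
               Σ² (λ g r → sel (indicator p g r) (f g r)) ≡ uncurry f p
Σ²-indicator f (k , s) = begin
  Σ² (λ g r → sel (does (g ≟ k) ∧ does (r ≟ s)) (f g r))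
    ≡⟨ Σℕ-cong (λ g → ≡-trans (Σℕ-cong (λ r → sel-∧ (does (g ≟ k)) _ (f g r)))
                               (Σℕ-sel (does (g ≟ k)) (λ r → sel (does (r ≟ s)) (f g r)))) ⟩
  Σℕ (λ g → sel (does (g ≟ k)) (Σℕ (λ r → sel (does (r ≟ s)) (f g r))))
    ≡⟨ Σℕ-indicator k _ ⟩
  Σℕ (λ r → sel (does (r ≟ s)) (f k r))
    ≡⟨ Σℕ-indicator s (f k) ⟩
  f k s ∎

Σ²-indicator-pair : ∀ {m n} (f : Fin m → Fin n → ℕ) {p q : Fin m × Fin n} → p ≢ q →
                    Σ² (λ g r → sel (indicator p g r ∨ indicator q g r) (f g r))
                      ≡ uncurry f p + uncurry f q
Σ²-indicator-pair f {p} {q} p≢q = begin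
  Σ² (λ g r → sel (indicator p g r ∨ indicator q g r) (f g r))
    ≡⟨ Σ²-cong (λ g r → sel-∨ _ _ (f g r) (disjoint g r)) ⟩
  Σ² (λ g r → sel (indicator p g r) (f g r) + sel (indicator q g r) (f g r))
    ≡⟨ Σ²-+ (λ g r → sel (indicator p g r) (f g r))
            (λ g r → sel (indicator q g r) (f g r)) ⟩
  Σ² (λ g r → sel (indicator p g r) (f g r)) + Σ² (λ g r → sel (indicator q g r) (f g r))
    ≡⟨ cong₂ _+_ (Σ²-indicator f p) (Σ²-indicator f q) ⟩
  uncurry f p + uncurry f q ∎
  where
  disjoint : ∀ g r → ¬ (indicator p g r ≡ true × indicator q g r ≡ true)
  disjoint g r (hit-p , hit-q) =
    p≢q (≡-trans (sym (indicator-sound p g r hit-p)) (indicator-sound q g r hit-q))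

∃-greatest : ∀ {n} → 0 < n → Σ (Fin n) λ L → ∀ g → g ≢ L → g <ᶠ L
∃-greatest {suc n} _ = fromℕ n , λ g g≢L → ≤∧≢⇒< (≤fromℕ g) g≢L

other₁ other₂ : Fin 3 → Fin 3
other₁ zero = suc zero
other₁ _    = zero
other₂ (suc (suc zero)) = suc zero
other₂ _                = suc (suc zero)

others-↭ : (w : Fin 3 → ℕ) (r : Fin 3) →
           (w r ∷ w (other₁ r) ∷ w (other₂ r) ∷ []) ↭ tabulate w
others-↭ w zero             = refl
others-↭ w (suc zero)       = swap _ _ refl
others-↭ w (suc (suc zero)) = ↭-sym (shift _ (w zero ∷ w (suc zero) ∷ []) [])

sum-triple : ∀ a b c → sum (a ∷ b ∷ c ∷ []) ≡ a + b + c
sum-triple a b c = ≡-trans (cong (λ t → a + (b + t)) (+-identityʳ c)) (sym (+-assoc a b c))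

SameMultiset2-swap : ∀ {x y a b} → SameMultiset2 x y a b → SameMultiset2 y x a b
SameMultiset2-swap (inj₁ (x≡a , y≡b)) = inj₂ (y≡b , x≡a)
SameMultiset2-swap (inj₂ (x≡b , y≡a)) = inj₁ (y≡a , x≡b)

SameMultiset2⇒↭ : ∀ {x y a b} → SameMultiset2 x y a b → (x ∷ y ∷ []) ↭ (a ∷ b ∷ [])
SameMultiset2⇒↭ (inj₁ (refl , refl)) = refl
SameMultiset2⇒↭ (inj₂ (refl , refl)) = swap _ _ refl

module _ (A : ANI) where
  open ANI A

  ↭-triple-sum : ∀ {a b c} k → (a ∷ b ∷ c ∷ []) ↭ tabulate (wT k) → a + b + c ≡ W
  ↭-triple-sum {a} {b} {c} k abc↭ = begin
    a + b + c                                           ≡⟨ sym (sum-triple a b c) ⟩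
    sum (a ∷ b ∷ c ∷ [])                                ≡⟨ sum-↭ abc↭ ⟩
    sum (tabulate (wT k))
      ≡⟨ sum-triple (wT k zero) (wT k (suc zero)) (wT k (suc (suc zero))) ⟩
    wT k zero + wT k (suc zero) + wT k (suc (suc zero)) ≡⟨ triple k ⟩
    W                                                   ∎

  others-∈F : ∀ k r → InF wT W (k , r) (wT k (other₁ r)) (wT k (other₂ r))
  others-∈F k r = (k , other₁ r) , (k , other₂ r) ,
    lift (distinct₁₂ r) , lift (distinct₁ r) , lift (distinct₂ r) , refl , refl ,
    ↭-triple-sum k (others-↭ (wT k) r)
    where
    lift : ∀ {s t} → s ≢ t → (k , s) ≢ (k , t)
    lift s≢t e = s≢t (cong proj₂ e)
    distinct₁₂ : ∀ r → other₁ r ≢ other₂ r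
    distinct₁₂ zero             ()
    distinct₁₂ (suc zero)       ()
    distinct₁₂ (suc (suc zero)) ()
    distinct₁ : ∀ r → other₁ r ≢ r
    distinct₁ zero             ()
    distinct₁ (suc zero)       ()
    distinct₁ (suc (suc zero)) ()
    distinct₂ : ∀ r → other₂ r ≢ r
    distinct₂ zero             ()
    distinct₂ (suc zero)       ()
    distinct₂ (suc (suc zero)) ()

  singleton⇒↭-triple : ∀ {k r x y} → FSingleton wT W (k , r) x y →
                       (wT k r ∷ x ∷ y ∷ []) ↭ tabulate (wT k)
  singleton⇒↭-triple {k} {r} (_ , unique) =
    trans (prep _ (↭-sym (SameMultiset2⇒↭ (unique _ _ (others-∈F k r)))))
          (others-↭ (wT k) r)

  earlier-pair-cannot-complete : ∀ k {p q : Item' h} → p ≢ q →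
    proj₁ p <ᶠ k → proj₁ q <ᶠ k →
    wT k zero + uncurry wT p + uncurry wT q ≢ W
  -- With no item of O chosen, the first sum of noSub reduces to 0 on Fin 15.
  earlier-pair-cannot-complete k {p} {q} p≢q p<k q<k completes =
    noSub k (λ _ → false) chosen earlier (begin
      Σ² (λ g r → sel (chosen g r) (wT g r)) + wT k zero
        ≡⟨ cong (_+ wT k zero) (Σ²-indicator-pair wT p≢q) ⟩
      uncurry wT p + uncurry wT q + wT k zero
        ≡⟨ xy∙z≈zx∙y (uncurry wT p) (uncurry wT q) (wT k zero) ⟩
      wT k zero + uncurry wT p + uncurry wT q ≡⟨ completes ⟩
      W                                       ∎)
    where
    chosen : Fin h → Fin 3 → Bool
    chosen g r = indicator p g r ∨ indicator q g r
    earlier : ∀ g r → chosen g r ≡ true → g <ᶠ k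
    earlier g r hit with indicator-∨-sound p q g r hit
    ... | inj₁ gr≡p = subst (λ i → proj₁ i <ᶠ k) (sym gr≡p) p<k
    ... | inj₂ gr≡q = subst (λ i → proj₁ i <ᶠ k) (sym gr≡q) q<k

  completion-in-triple : ∀ k s → s ≢ zero → ∀ z → wT k zero + wT k s + z ≡ W →
    SameMultiset2 (wT k s) z (wT k (suc zero)) (wT k (suc (suc zero)))
  completion-in-triple k zero s≢0 z _ = ⊥-elim (s≢0 refl)
  completion-in-triple k (suc zero) _ z completes =
    inj₁ (refl , +-cancelˡ-≡ (wT k zero + wT k (suc zero)) z _
                   (≡-trans completes (sym (triple k))))
  completion-in-triple k (suc (suc zero)) _ z completes =
    inj₂ (refl , +-cancelˡ-≡ (wT k zero + wT k (suc (suc zero))) z _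
                   (≡-trans completes (sym (↭-triple-sum k (prep _ (swap _ _ refl))))))

  last-a-F-unique : ∀ L → (∀ g → g ≢ L → g <ᶠ L) → ∀ x y → InF wT W (L , zero) x y →
                    SameMultiset2 x y (wT L (suc zero)) (wT L (suc (suc zero)))
  last-a-F-unique L greatest _ _
    ((kb , rb) , (kc , rc) , b≢c , b≢a , c≢a , refl , refl , completes) with kb ≟ L | kc ≟ L
  ... | yes refl | _ =
    completion-in-triple L rb (λ rb≡0 → b≢a (cong (L ,_) rb≡0)) _ completes
  ... | no _ | yes refl =
    SameMultiset2-swap (completion-in-triple L rc (λ rc≡0 → c≢a (cong (L ,_) rc≡0)) _
      (≡-trans (xy∙z≈xz∙y (wT L zero) (wT L rc) (wT kb rb)) completes))
  ... | no kb≢L | no kc≢L =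
    ⊥-elim (earlier-pair-cannot-complete L b≢c (greatest kb kb≢L) (greatest kc kc≢L)
                                         completes)

  last-a-singleton : 0 < h →
                     Σ (Item' h) λ a → Σ ℕ λ x → Σ ℕ λ y → FSingleton wT W a x y
  last-a-singleton h>0 with ∃-greatest h>0
  ... | L , greatest = (L , zero) , _ , _ , others-∈F L zero , last-a-F-unique L greatest

theorem1 : (I : AI) →
    0 < ANI.h (AI.base I) →
    (Σ (Item' (ANI.h (AI.base I))) λ a → Σ ℕ λ x → Σ ℕ λ y →
      FSingleton (ANI.wT (AI.base I)) (ANI.W (AI.base I)) a x y) ×
    (∀ (a : Item' (ANI.h (AI.base I))) (x y : ℕ) →
      FSingleton (ANI.wT (AI.base I)) (ANI.W (AI.base I)) a x y →
      Σ (Fin (ANI.h (AI.base I))) λ k →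
        (ANI.wT (AI.base I) (proj₁ a) (proj₂ a) ∷ x ∷ y ∷ []) ↭
        (ANI.wT (AI.base I) k zero ∷ ANI.wT (AI.base I) k (suc zero) ∷
          ANI.wT (AI.base I) k (suc (suc zero)) ∷ []))
theorem1 I h>0 =
  last-a-singleton (AI.base I) h>0 ,
  λ { (k , r) x y singleton → k , singleton⇒↭-triple (AI.base I) singleton }
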